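{- Let $A$ be an alphabet with at least two letters and $f: A^*\to B^*$ a non-erasing morphism which is not prefix or not suffix. Then $f$ is weakly quasiperiodic on finite words and weakly quasiperiodic on infinite words.
   Context: A morphism $f$ is prefix (resp. suffix) if for all distinct letters $a,b\in A$, $f(a)$ is not a prefix (resp. suffix) of $f(b)$. For a non-empty word $q$, a finite word $w$ is $q$-quasiperiodic if $w\neq q$ and every position of $w$ lies within some occurrence of $q$ in $w$; an infinite word is $q$-quasiperiodic if every position lies within some occurrence of $q$; a word is quasiperiodic if it is $q$-quasiperiodic for some $q$. $f$ is weakly quasiperiodic on finite words if there is a finite non-quasiperiodic word $u$ over $A$ with $f(u)$ quasiperiodic; it is weakly quasiperiodic on infinite words if there is an infinite non-quasiperiodic word $\mathbf{w}$ over $A$ with $f(\mathbf{w})$ quasiperiodic. -}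

module Defs where

open import Data.Nat using (ℕ; zero; suc; _+_; _≤_; _<_; s≤s; z≤n)
open import Data.Nat.Properties using (≤-trans; +-mono-≤)
open import Data.Fin using (Fin; toℕ; fromℕ<)
open import Data.List using (List; []; _∷_; _++_; length; lookup; concatMap; applyUpTo)
open import Data.List.Properties using (length-++)
open import Data.Product using (Σ; ∃; _×_; _,_)
open import Data.Sum using (_⊎_)
open import Relation.Nullary using (¬_)
open import Relation.Binary.PropositionalEquality using (_≡_; _≢_; refl; subst; sym)

-- Words over an alphabet A: finite words are List A, infinite words are ℕ → A.

-- A morphism A* → B* is determined by the images of letters f : A → List B,
-- and acts on finite words by concatMap f.
NonErasing : {A B : Set} → (A → List B) → Set
NonErasing f = ∀ a → f a ≢ []

IsPrefix : {B : Set} → List B → List B → Set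
IsPrefix u v = ∃ λ t → u ++ t ≡ v

IsSuffix : {B : Set} → List B → List B → Set
IsSuffix u v = ∃ λ t → t ++ u ≡ v

PrefixMorphism : {A B : Set} → (A → List B) → Set
PrefixMorphism f = ∀ a b → a ≢ b → ¬ IsPrefix (f a) (f b)

SuffixMorphism : {A B : Set} → (A → List B) → Set
SuffixMorphism f = ∀ a b → a ≢ b → ¬ IsSuffix (f a) (f b)

OccursAt : {B : Set} → List B → List B → ℕ → Set
OccursAt q w j = ∃ λ u → ∃ λ v → (w ≡ u ++ q ++ v) × (length u ≡ j)

QPeriodic : {B : Set} → List B → List B → Set
QPeriodic q w =
  (q ≢ []) × (w ≢ q) ×
  (∀ i → i < length w → ∃ λ j → (j ≤ i) × (i < j + length q) × OccursAt q w j)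

Quasiperiodic : {B : Set} → List B → Set
Quasiperiodic w = ∃ λ q → QPeriodic q w

OccursAtω : {B : Set} → List B → (ℕ → B) → ℕ → Set
OccursAtω q x j = ∀ (k : Fin (length q)) → x (j + toℕ k) ≡ lookup q k

QPeriodicω : {B : Set} → List B → (ℕ → B) → Set
QPeriodicω q x =
  (q ≢ []) × (∀ i → ∃ λ j → (j ≤ i) × (i < j + length q) × OccursAtω q x j)

Quasiperiodicω : {B : Set} → (ℕ → B) → Set
Quasiperiodicω x = ∃ λ q → QPeriodicω q x

-- Image of an infinite word under a non-erasing morphism.
-- f(w) is the infinite word whose prefixes are f(w 0 w 1 ... w (n-1)).
private
  ne⇒len : {A B : Set} (f : A → List B) → NonErasing f → ∀ a → 1 ≤ length (f a)
  ne⇒len f ne a with f a | ne a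
  ... | []    | h with () ← h refl
  ... | _ ∷ _ | _ = s≤s z≤n

  lenConcat : {A B : Set} (f : A → List B) → NonErasing f →
              ∀ xs → length xs ≤ length (concatMap f xs)
  lenConcat f ne [] = z≤n
  lenConcat f ne (x ∷ xs) =
    subst (λ m → suc (length xs) ≤ m) (sym (length-++ (f x)))
      (+-mono-≤ (ne⇒len f ne x) (lenConcat f ne xs))

  lenApply : {A : Set} (w : ℕ → A) → ∀ n → length (applyUpTo w n) ≡ n
  lenApply w zero = refl
  lenApply w (suc n) rewrite lenApply (λ k → w (suc k)) n = refl

image : {A B : Set} (f : A → List B) → NonErasing f → (ℕ → A) → (ℕ → B)
image f ne w p =
  lookup (concatMap f (applyUpTo w (suc p)))
    (fromℕ< (≤-trans (subst (λ m → suc p ≤ m) (sym (lenApply w (suc p))) (Data.Nat.Properties.≤-refl))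
                     (lenConcat f ne (applyUpTo w (suc p)))))

WeaklyQPFinite : {A B : Set} → (A → List B) → Set
WeaklyQPFinite {A} f = ∃ λ (u : List A) → ¬ Quasiperiodic u × Quasiperiodic (concatMap f u)

WeaklyQPInfinite : {A B : Set} (f : A → List B) → NonErasing f → Set
WeaklyQPInfinite {A} f ne =
  ∃ λ (w : ℕ → A) → ¬ Quasiperiodicω w × Quasiperiodicω (image f ne w)

-- If f(b) = f(a)t, then f(bba) = (f(b)f(a))(tf(a)) = f(b)(f(b)f(a)) carries two overlapping
-- occurrences of q = f(b)f(a), so it is q-quasiperiodic, whereas bba is unbordered and hence
-- not quasiperiodic. In the same way f(b(ba)^ω) = f(b)(f(b)f(a))^ω is covered by the
-- occurrences of q at 0 and at |f(b)| + k|q|, whereas in b(ba)^ω the letter square at 0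
-- cannot be repeated by a later occurrence of a quasiperiod. If instead f(b) = tf(a), the
-- words abb and a(ab)^ω work, the latter with quasiperiod f(a)f(a)t since
-- f(a)(f(a)tf(a))^ω = (f(a)f(a)t)^ω.

module Submission where

open import Defs
open import Data.Nat using (ℕ; zero; suc; _+_; _∸_; _*_; _≤_; _<_; s≤s; z≤n; s<s⁻¹; s≤s⁻¹; z<s; NonZero)
open import Data.Nat.Properties
  using (≤-refl; ≤-trans; ≤-total; ≤-antisym; ≮⇒≥; ≤⇒≯; <-≤-trans; n≮n; _<?_; m≤m+n; m<m+n; +-assoc; +-comm;
         +-identityʳ; +-monoʳ-≤; +-monoʳ-<; +-monoˡ-<; m+[n∸m]≡n; module ≤-Reasoning)
open import Data.Nat.DivMod using (_/_; _%_; m≡m%n+[m/n]*n; m%n<n; m/n*n≤m)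
open import Data.Fin using (Fin; toℕ; fromℕ<; _≟_)
open import Data.Fin.Properties using (toℕ<n; all?; ¬∀⟶∃¬)
open import Data.List using (List; []; _∷_; _++_; length; lookup; concatMap; applyUpTo)
open import Algebra.Bundles using (Monoid)
open import Data.List.Properties using (++-monoid; length-++; length-++-≤ˡ; concatMap-++; ++-assoc; ++-identityʳ; ++-identityˡ-unique; ++-conicalˡ)
open import Data.List.Relation.Binary.Prefix.Heterogeneous.Properties using (prefix?)
open import Data.List.Relation.Binary.Suffix.Heterogeneous.Properties using (suffix?)
open import Data.List.Relation.Binary.Prefix.Propositional.Properties using (Prefix-as-∣ˡ; ∣ˡ-as-Prefix)
open import Data.List.Relation.Binary.Suffix.Propositional.Properties using (Suffix-as-∣ʳ; ∣ʳ-as-Suffix)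
open import Data.Product using (∃; ∃₂; _×_; _,_)
open import Data.Empty using (⊥)
open import Data.Sum using (_⊎_; inj₁; inj₂)
open import Relation.Binary.Definitions using (Decidable; DecidableEquality)
open import Relation.Nullary using (¬_; Dec; yes; no; ¬?; contradiction)
open import Relation.Nullary.Decidable using (map′; _→-dec_; decidable-stable)
open import Relation.Binary.PropositionalEquality
open import Function using (_∘′_; const)

module _ {B : Set} where

  power : ℕ → List B → List B
  power zero    q = []
  power (suc k) q = q ++ power k q

  length-power : ∀ k (q : List B) → length (power k q) ≡ k * length q
  length-power zero    q = refl
  length-power (suc k) q = trans (length-++ q) (cong (length q +_) (length-power k q))

  power-comm : ∀ k (q : List B) → power k q ++ q ≡ q ++ power k q
  power-comm zero    q = sym (++-identityʳ q)
  power-comm (suc k) q = trans (++-assoc q (power k q) q) (cong (q ++_) (power-comm k q))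

  power-conjugate : ∀ k (u v : List B) → u ++ power k (v ++ u) ≡ power k (u ++ v) ++ u
  power-conjugate zero    u v = ++-identityʳ u
  power-conjugate (suc k) u v = begin
    u ++ (v ++ u) ++ power k (v ++ u)     ≡⟨ cong (u ++_) (++-assoc v u _) ⟩
    u ++ v ++ u ++ power k (v ++ u)       ≡⟨ cong (λ r → u ++ v ++ r) (power-conjugate k u v) ⟩
    u ++ v ++ power k (u ++ v) ++ u       ≡⟨ ++-assoc u v _ ⟨
    (u ++ v) ++ power k (u ++ v) ++ u     ≡⟨ ++-assoc (u ++ v) _ u ⟨
    ((u ++ v) ++ power k (u ++ v)) ++ u   ∎
    where open ≡-Reasoning

  ++-≢[] : (u v : List B) → u ≢ [] → u ++ v ≢ []
  ++-≢[] u v u≢[] = u≢[] ∘′ ++-conicalˡ u v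

  length-++-++ : ∀ (u q v : List B) → length (u ++ q ++ v) ≡ length u + length q + length v
  length-++-++ u q v =
    trans (length-++ u) (trans (cong (length u +_) (length-++ q)) (sym (+-assoc (length u) _ _)))

  IsBorder : List B → List B → Set
  IsBorder q w = q ≢ [] × q ≢ w × IsPrefix q w × IsSuffix q w

  -- The empty word is vacuously quasiperiodic under this definition, hence c ∷ w.
  QPeriodic⇒IsBorder : ∀ {q c w} → QPeriodic q (c ∷ w) → IsBorder q (c ∷ w)
  QPeriodic⇒IsBorder {q} {c} {w} (q≢[] , w≢q , cover) =
    q≢[] , w≢q ∘′ sym , first , last (cover (length w) ≤-refl)
    where
      first : IsPrefix q (c ∷ w)
      first with cover 0 z<s
      ... | .0 , z≤n , _ , [] , v , eq , _ = v , sym eq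
      last : (∃ λ j → (j ≤ length w) × (length w < j + length q) × OccursAt q (c ∷ w) j) →
             IsSuffix q (c ∷ w)
      last (j , _ , w<j+q , u , v , eq , refl) with v
      ... | [] = u , sym (trans eq (cong (u ++_) (++-identityʳ q)))
      ... | b ∷ v′ = contradiction w<j+q (≤⇒≯ lengths)
        where
          lengths : length u + length q ≤ length w
          lengths = s≤s⁻¹ (begin
            suc (length u + length q)               ≤⟨ m<m+n (length u + length q) z<s ⟩
            length u + length q + length (b ∷ v′)   ≡⟨ length-++-++ u q _ ⟨
            length (u ++ q ++ b ∷ v′)               ≡⟨ cong length eq ⟨
            suc (length w)                          ∎)
            where open ≤-Reasoning

  overlapping-border⇒QPeriodic : ∀ {q u w : List B} → q ≢ [] → u ≢ [] → length u ≤ length q →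
                                 IsPrefix q w → u ++ q ≡ w → QPeriodic q w
  overlapping-border⇒QPeriodic {q} {u} {w} q≢[] u≢[] u≤q (v , q++v≡w) u++q≡w = q≢[] , w≢q , cover
    where
      w≢q : w ≢ q
      w≢q w≡q = u≢[] (++-identityˡ-unique u (sym (trans u++q≡w w≡q)))
      cover : ∀ i → i < length w → ∃ λ j → (j ≤ i) × (i < j + length q) × OccursAt q w j
      cover i i<w with i <? length q
      ... | yes i<q = 0 , z≤n , i<q , [] , v , sym q++v≡w , refl
      ... | no i≮q  = length u , ≤-trans u≤q (≮⇒≥ i≮q) , i<u+q , u , [] , w≡u++q++[] , refl
        where
          i<u+q : i < length u + length q
          i<u+q = subst (i <_) (trans (cong length (sym u++q≡w)) (length-++ u)) i<w
          w≡u++q++[] : w ≡ u ++ q ++ []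
          w≡u++q++[] = sym (trans (cong (u ++_) (++-identityʳ q)) u++q≡w)

  three-letters-unbordered : ∀ {c₀ c₁ c₂ : B} {q} → c₀ ≢ c₂ → ¬ IsBorder q (c₀ ∷ c₁ ∷ c₂ ∷ [])
  three-letters-unbordered {q = []}                c₀≢c₂ (q≢[] , _) = q≢[] refl
  three-letters-unbordered {q = _ ∷ []}            c₀≢c₂ (_ , _ , (_ , refl) , suffix) with suffix
  ... | []              , ()
  ... | _ ∷ []          , ()
  ... | _ ∷ _ ∷ []      , refl = c₀≢c₂ refl
  ... | _ ∷ _ ∷ _ ∷ []  , ()
  ... | _ ∷ _ ∷ _ ∷ _ ∷ _ , ()
  three-letters-unbordered {q = _ ∷ _ ∷ []}        c₀≢c₂ (_ , _ , (_ , refl) , suffix) with suffix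
  ... | []              , ()
  ... | _ ∷ []          , refl = c₀≢c₂ refl
  ... | _ ∷ _ ∷ []      , ()
  ... | _ ∷ _ ∷ _ ∷ []  , ()
  ... | _ ∷ _ ∷ _ ∷ _ ∷ _ , ()
  three-letters-unbordered {q = _ ∷ _ ∷ _ ∷ []}    c₀≢c₂ (_ , q≢w , (_ , refl) , _) = q≢w refl
  three-letters-unbordered {q = _ ∷ _ ∷ _ ∷ _ ∷ _} c₀≢c₂ (_ , _ , (_ , ()) , _)

  three-letters-¬Quasiperiodic : ∀ {c₀ c₁ c₂ : B} → c₀ ≢ c₂ → ¬ Quasiperiodic (c₀ ∷ c₁ ∷ c₂ ∷ [])
  three-letters-¬Quasiperiodic c₀≢c₂ (q , qp) = three-letters-unbordered c₀≢c₂ (QPeriodic⇒IsBorder qp)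

  lookup-isPrefix : ∀ {l l′ : List B} → IsPrefix l l′ → ∀ {p} .(p<l : p < length l) .(p<l′ : p < length l′) →
                    lookup l (fromℕ< p<l) ≡ lookup l′ (fromℕ< p<l′)
  lookup-isPrefix {[]}    (t , refl) {p}     () _
  lookup-isPrefix {x ∷ l} (t , refl) {zero}  _ _ = refl
  lookup-isPrefix {x ∷ l} (t , refl) {suc p} p<l p<l′ = lookup-isPrefix {l} (t , refl) (s<s⁻¹ p<l) (s<s⁻¹ p<l′)

  lookup-infix : ∀ (u q v : List B) (k : Fin (length q)) .(bound : length u + toℕ k < length (u ++ q ++ v)) →
                 lookup (u ++ q ++ v) (fromℕ< bound) ≡ lookup q k
  lookup-infix []      (x ∷ q) v Fin.zero    _     = refl
  lookup-infix []      (x ∷ q) v (Fin.suc k) bound = lookup-infix [] q v k (s<s⁻¹ bound)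
  lookup-infix (x ∷ u) q       v k           bound = lookup-infix u q v k (s<s⁻¹ bound)

  infix-bound : ∀ (u q v : List B) (k : Fin (length q)) → length u + toℕ k < length (u ++ q ++ v)
  infix-bound u q v k = begin-strict
    length u + toℕ k                     <⟨ +-monoʳ-< (length u) (<-≤-trans (toℕ<n k) (m≤m+n _ _)) ⟩
    length u + (length q + length v)     ≡⟨ +-assoc (length u) _ _ ⟨
    length u + length q + length v       ≡⟨ length-++-++ u q v ⟨
    length (u ++ q ++ v)                 ∎
    where open ≤-Reasoning

applyUpTo-isPrefix : ∀ {A : Set} (w : ℕ → A) {N M} → N ≤ M → IsPrefix (applyUpTo w N) (applyUpTo w M)
applyUpTo-isPrefix w {M = M} z≤n = applyUpTo w M , refl
applyUpTo-isPrefix w (s≤s N≤M) with applyUpTo-isPrefix (λ n → w (suc n)) N≤M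
... | t , eq = t , cong (w 0 ∷_) eq

concatMap-isPrefix : ∀ {A B : Set} (f : A → List B) {l l′} → IsPrefix l l′ →
                     IsPrefix (concatMap f l) (concatMap f l′)
concatMap-isPrefix f {l} (t , refl) = concatMap f t , sym (concatMap-++ f l t)

module Image {A B : Set} (f : A → List B) (ne : NonErasing f) (w : ℕ → A) where

  imagePrefix : ℕ → List B
  imagePrefix N = concatMap f (applyUpTo w N)

  imagePrefix-isPrefix : ∀ {N M} → N ≤ M → IsPrefix (imagePrefix N) (imagePrefix M)
  imagePrefix-isPrefix N≤M = concatMap-isPrefix f (applyUpTo-isPrefix w N≤M)

  image-lookup : ∀ N p .(p<N : p < length (imagePrefix N)) →
                 image f ne w p ≡ lookup (imagePrefix N) (fromℕ< p<N)
  image-lookup N p p<N with ≤-total (suc p) N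
  ... | inj₁ 1+p≤N = lookup-isPrefix (imagePrefix-isPrefix 1+p≤N) _ p<N
  ... | inj₂ N≤1+p = sym (lookup-isPrefix (imagePrefix-isPrefix N≤1+p) p<N _)

  occurs-in-image : ∀ N u q v → u ++ q ++ v ≡ imagePrefix N → OccursAtω q (image f ne w) (length u)
  occurs-in-image N u q v eq k = begin
    image f ne w (length u + toℕ k)             ≡⟨ image-lookup N _ (subst (λ l → _ < length l) eq bound) ⟩
    lookup (imagePrefix N) (fromℕ< _)           ≡⟨ lookup-isPrefix ([] , trans (++-identityʳ _) eq) bound _ ⟨
    lookup (u ++ q ++ v) (fromℕ< bound)         ≡⟨ lookup-infix u q v k bound ⟩
    lookup q k                                  ∎
    where
      open ≡-Reasoning
      bound : length u + toℕ k < length (u ++ q ++ v)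
      bound = infix-bound u q v k

  occurs-in-power : ∀ N u q v k → u ++ power (suc k) q ++ v ≡ imagePrefix N →
                    OccursAtω q (image f ne w) (length u + k * length q)
  occurs-in-power N u q v k eq =
    subst (OccursAtω q (image f ne w)) length-u++qᵏ (occurs-in-image N (u ++ power k q) q v eq′)
    where
      length-u++qᵏ : length (u ++ power k q) ≡ length u + k * length q
      length-u++qᵏ = trans (length-++ u) (cong (length u +_) (length-power k q))
      eq′ : (u ++ power k q) ++ q ++ v ≡ imagePrefix N
      eq′ = begin
        (u ++ power k q) ++ q ++ v    ≡⟨ ++-assoc u (power k q) _ ⟩
        u ++ power k q ++ q ++ v      ≡⟨ cong (u ++_) (++-assoc (power k q) q v) ⟨
        u ++ (power k q ++ q) ++ v    ≡⟨ cong (λ r → u ++ r ++ v) (power-comm k q) ⟩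
        u ++ power (suc k) q ++ v     ≡⟨ eq ⟩
        imagePrefix N                 ∎
        where open ≡-Reasoning

block-containing : ∀ p l .{{_ : NonZero l}} i → p ≤ i → ∃ λ k → (p + k * l ≤ i) × (i < p + k * l + l)
block-containing p l i p≤i = k , lower , upper
  where
    open ≤-Reasoning
    r : ℕ
    r = i ∸ p
    k : ℕ
    k = r / l
    lower : p + k * l ≤ i
    lower = begin
      p + k * l  ≤⟨ +-monoʳ-≤ p (m/n*n≤m r l) ⟩
      p + r      ≡⟨ m+[n∸m]≡n p≤i ⟩
      i          ∎
    upper : i < p + k * l + l
    upper = begin-strict
      i                  ≡⟨ m+[n∸m]≡n p≤i ⟨
      p + r              ≡⟨ cong (p +_) (m≡m%n+[m/n]*n r l) ⟩
      p + (r % l + k * l) <⟨ +-monoʳ-< p (+-monoˡ-< (k * l) (m%n<n r l)) ⟩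
      p + (l + k * l)    ≡⟨ cong (p +_) (+-comm l (k * l)) ⟩
      p + (k * l + l)    ≡⟨ +-assoc p (k * l) l ⟨
      p + k * l + l      ∎

nonZero-length : ∀ {B : Set} {q : List B} → q ≢ [] → NonZero (length q)
nonZero-length {q = []}    q≢[] = contradiction refl q≢[]
nonZero-length {q = _ ∷ _} _    = _

module _ {B : Set} {x : ℕ → B} where

  QPeriodicω⇒occurs-at-0 : ∀ {q} → QPeriodicω q x → OccursAtω q x 0
  QPeriodicω⇒occurs-at-0 (_ , cover) with cover 0
  ... | .0 , z≤n , _ , at0 = at0

  arithmetic-occurrences⇒QPeriodicω : ∀ {q} p → q ≢ [] → p ≤ length q → OccursAtω q x 0 →
                                      (∀ k → OccursAtω q x (p + k * length q)) → QPeriodicω q x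
  arithmetic-occurrences⇒QPeriodicω {q} p q≢[] p≤q at0 atBlock = q≢[] , cover
    where
      cover : ∀ i → ∃ λ j → (j ≤ i) × (i < j + length q) × OccursAtω q x j
      cover i with i <? length q
      ... | yes i<q = 0 , z≤n , i<q , at0
      ... | no  i≮q with block-containing p (length q) {{nonZero-length q≢[]}} i (≤-trans p≤q (≮⇒≥ i≮q))
      ...   | k , lower , upper = p + k * length q , lower , upper , atBlock k

  letter-quasiperiod⇒constant : ∀ {c} → QPeriodicω (c ∷ []) x → ∀ i → x i ≡ c
  letter-quasiperiod⇒constant (_ , cover) i with cover i
  ... | j , j≤i , i<j+1 , occ = trans (cong x i≡j+0) (occ Fin.zero)
    where
      i≡j+0 : i ≡ j + 0
      i≡j+0 = trans (≤-antisym (s≤s⁻¹ (subst (suc i ≤_) (+-comm j 1) i<j+1)) j≤i) (sym (+-identityʳ j))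

leading-square⇒¬Quasiperiodicω : ∀ {A : Set} (x : ℕ → A) → x 0 ≡ x 1 →
                                 (∀ j → x (suc j) ≢ x (suc (suc j))) → ¬ Quasiperiodicω x
leading-square⇒¬Quasiperiodicω x square noSquare (_ , qp) = refute _ qp
  where
    refute : ∀ q → QPeriodicω q x → ⊥
    refute []           (q≢[] , _) = q≢[] refl
    refute (c ∷ [])     qp         = noSquare 0 (trans (constant 1) (sym (constant 2)))
      where
        constant : ∀ i → x i ≡ c
        constant = letter-quasiperiod⇒constant {x = x} qp
    refute (c ∷ c′ ∷ q′) qp@(_ , cover) with cover (length (c ∷ c′ ∷ q′))
    ... | zero  , _ , q<q , _   = n≮n _ q<q
    ... | suc j , _ , _   , occ = noSquare j (begin
      x (suc j)           ≡⟨ cong x (+-identityʳ (suc j)) ⟨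
      x (suc j + 0)       ≡⟨ occ Fin.zero ⟩
      c                   ≡⟨ at0 Fin.zero ⟨
      x 0                 ≡⟨ square ⟩
      x 1                 ≡⟨ at0 (Fin.suc Fin.zero) ⟩
      c′                  ≡⟨ occ (Fin.suc Fin.zero) ⟨
      x (suc j + 1)       ≡⟨ cong x (+-comm (suc j) 1) ⟩
      x (suc (suc j))     ∎)
      where
        open ≡-Reasoning
        at0 : OccursAtω (c ∷ c′ ∷ q′) x 0
        at0 = QPeriodicω⇒occurs-at-0 {x = x} qp

module _ {A : Set} (d e : A) where

  alternate : ℕ → A
  alternate zero          = d
  alternate (suc zero)    = e
  alternate (suc (suc n)) = alternate n

  d[de]^ω : ℕ → A
  d[de]^ω zero    = d
  d[de]^ω (suc n) = alternate n

  alternate-squarefree : d ≢ e → ∀ j → alternate j ≢ alternate (suc j)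
  alternate-squarefree d≢e zero          = d≢e
  alternate-squarefree d≢e (suc zero)    = d≢e ∘′ sym
  alternate-squarefree d≢e (suc (suc j)) = alternate-squarefree d≢e j

  d[de]^ω-¬Quasiperiodicω : d ≢ e → ¬ Quasiperiodicω d[de]^ω
  d[de]^ω-¬Quasiperiodicω d≢e = leading-square⇒¬Quasiperiodicω d[de]^ω refl (alternate-squarefree d≢e)

  concatMap-alternate : ∀ {B : Set} (f : A → List B) k →
                        concatMap f (applyUpTo alternate (k * 2)) ≡ power k (f d ++ f e)
  concatMap-alternate f zero    = refl
  concatMap-alternate f (suc k) =
    trans (sym (++-assoc (f d) (f e) _)) (cong ((f d ++ f e) ++_) (concatMap-alternate f k))

module _ {A B : Set} (f : A → List B) (ne : NonErasing f) {a b : A} (a≢b : a ≢ b) where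

  prefix-pair⇒weaklyQP : IsPrefix (f a) (f b) → WeaklyQPFinite f × WeaklyQPInfinite f ne
  prefix-pair⇒weaklyQP (t , fa++t≡fb) = finite , infinite
    where
      q : List B
      q = f b ++ f a
      q≢[] : q ≢ []
      q≢[] = ++-≢[] (f b) (f a) (ne b)
      image-bba : q ++ t ++ f a ≡ concatMap f (b ∷ b ∷ a ∷ [])
      image-bba = begin
        (f b ++ f a) ++ t ++ f a    ≡⟨ ++-assoc (f b) (f a) _ ⟩
        f b ++ f a ++ t ++ f a      ≡⟨ cong (f b ++_) (++-assoc (f a) t (f a)) ⟨
        f b ++ (f a ++ t) ++ f a    ≡⟨ cong (λ r → f b ++ r ++ f a) fa++t≡fb ⟩
        f b ++ f b ++ f a           ≡⟨ cong (λ r → f b ++ f b ++ r) (++-identityʳ (f a)) ⟨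
        f b ++ f b ++ f a ++ []     ∎
        where open ≡-Reasoning
      finite : WeaklyQPFinite f
      finite = b ∷ b ∷ a ∷ [] , three-letters-¬Quasiperiodic (a≢b ∘′ sym) , q ,
        overlapping-border⇒QPeriodic q≢[] (ne b) (length-++-≤ˡ (f b)) (t ++ f a , image-bba)
          (cong (λ r → f b ++ f b ++ r) (sym (++-identityʳ (f a))))
      x : ℕ → A
      x = d[de]^ω b a
      open Image f ne x
      block : ∀ k → OccursAtω q (image f ne x) (length (f b) + k * length q)
      block k = occurs-in-power (suc (suc k * 2)) (f b) q [] k
        (cong (f b ++_) (trans (++-identityʳ _) (sym (concatMap-alternate b a f (suc k)))))
      infinite : WeaklyQPInfinite f ne
      infinite = x , d[de]^ω-¬Quasiperiodicω b a (a≢b ∘′ sym) , q ,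
        arithmetic-occurrences⇒QPeriodicω {x = image f ne x} (length (f b)) q≢[] (length-++-≤ˡ (f b))
          (occurs-in-image 3 [] q (t ++ f a) image-bba) block

  suffix-pair⇒weaklyQP : IsSuffix (f a) (f b) → WeaklyQPFinite f × WeaklyQPInfinite f ne
  suffix-pair⇒weaklyQP (t , t++fa≡fb) = finite , infinite
    where
      open ≡-Reasoning
      finite : WeaklyQPFinite f
      finite = a ∷ b ∷ b ∷ [] , three-letters-¬Quasiperiodic a≢b , f a ++ f b ,
        overlapping-border⇒QPeriodic (++-≢[] (f a) (f b) (ne a)) (++-≢[] (f a) t (ne a)) fa++t≤fa++fb
          (f b ++ [] , ++-assoc (f a) (f b) _) image-abb
        where
          fa++t++fa≡fa++fb : (f a ++ t) ++ f a ≡ f a ++ f b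
          fa++t++fa≡fa++fb = trans (++-assoc (f a) t (f a)) (cong (f a ++_) t++fa≡fb)
          fa++t≤fa++fb : length (f a ++ t) ≤ length (f a ++ f b)
          fa++t≤fa++fb = subst (λ r → length (f a ++ t) ≤ length r) fa++t++fa≡fa++fb (length-++-≤ˡ (f a ++ t))
          image-abb : (f a ++ t) ++ f a ++ f b ≡ concatMap f (a ∷ b ∷ b ∷ [])
          image-abb = begin
            (f a ++ t) ++ f a ++ f b    ≡⟨ ++-assoc (f a ++ t) (f a) (f b) ⟨
            ((f a ++ t) ++ f a) ++ f b  ≡⟨ cong (_++ f b) fa++t++fa≡fa++fb ⟩
            (f a ++ f b) ++ f b         ≡⟨ ++-assoc (f a) (f b) (f b) ⟩
            f a ++ f b ++ f b           ≡⟨ cong (λ r → f a ++ f b ++ r) (++-identityʳ (f b)) ⟨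
            f a ++ f b ++ f b ++ []     ∎
      q : List B
      q = f a ++ f a ++ t
      x : ℕ → A
      x = d[de]^ω a b
      open Image f ne x
      block : ∀ k → OccursAtω q (image f ne x) (k * length q)
      block k = occurs-in-power (suc (suc k * 2)) [] q (f a) k (begin
        power (suc k) (f a ++ f a ++ t) ++ f a     ≡⟨ power-conjugate (suc k) (f a) (f a ++ t) ⟨
        f a ++ power (suc k) ((f a ++ t) ++ f a)   ≡⟨ cong (λ r → f a ++ power (suc k) r) (++-assoc (f a) t (f a)) ⟩
        f a ++ power (suc k) (f a ++ t ++ f a)     ≡⟨ cong (λ r → f a ++ power (suc k) (f a ++ r)) t++fa≡fb ⟩
        f a ++ power (suc k) (f a ++ f b)          ≡⟨ cong (f a ++_) (concatMap-alternate a b f (suc k)) ⟨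
        imagePrefix (suc (suc k * 2))              ∎)
      infinite : WeaklyQPInfinite f ne
      infinite = x , d[de]^ω-¬Quasiperiodicω a b a≢b , q ,
        arithmetic-occurrences⇒QPeriodicω {x = image f ne x} 0 (++-≢[] (f a) _ (ne a)) z≤n (block 0) block

module _ {B : Set} where
  open import Algebra.Definitions.RawMagma (Monoid.rawMagma (++-monoid B)) using (_,_)

  isPrefix? : DecidableEquality B → Decidable (IsPrefix {B})
  isPrefix? _≟_ u v = map′ (λ p → let t , eq = Prefix-as-∣ˡ p in t , eq) (λ (t , eq) → ∣ˡ-as-Prefix (t , eq))
                           (prefix? _≟_ u v)

  isSuffix? : DecidableEquality B → Decidable (IsSuffix {B})
  isSuffix? _≟_ u v = map′ (λ s → let t , eq = Suffix-as-∣ʳ s in t , eq) (λ (t , eq) → ∣ʳ-as-Suffix (t , eq))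
                           (suffix? _≟_ u v)

module _ {n : ℕ} {R : Fin n → Fin n → Set} (R? : Decidable R) where

  private
    distinct⇒¬R? : ∀ a b → Dec (a ≢ b → ¬ R a b)
    distinct⇒¬R? a b = ¬? (a ≟ b) →-dec ¬? (R? a b)

  ¬∀distinct⇒∃distinct : ¬ (∀ a b → a ≢ b → ¬ R a b) → ∃₂ λ a b → a ≢ b × R a b
  ¬∀distinct⇒∃distinct h with ¬∀⟶∃¬ n _ (λ a → all? (distinct⇒¬R? a)) h
  ... | a , ¬∀b with ¬∀⟶∃¬ n _ (distinct⇒¬R? a) ¬∀b
  ... | b , ¬Rab = a , b , (λ a≡b → ¬Rab (contradiction a≡b)) , decidable-stable (R? a b) (¬Rab ∘′ const)

lemma6p1 : (n m : ℕ) → 2 ≤ n → (f : Fin n → List (Fin m)) → (ne : NonErasing f) →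
    (¬ PrefixMorphism f ⊎ ¬ SuffixMorphism f) →
    WeaklyQPFinite f × WeaklyQPInfinite f ne
lemma6p1 n m _ f ne (inj₁ ¬prefix) with ¬∀distinct⇒∃distinct (λ a b → isPrefix? _≟_ (f a) (f b)) ¬prefix
... | a , b , a≢b , fa⊑fb = prefix-pair⇒weaklyQP f ne a≢b fa⊑fb
lemma6p1 n m _ f ne (inj₂ ¬suffix) with ¬∀distinct⇒∃distinct (λ a b → isSuffix? _≟_ (f a) (f b)) ¬suffix
... | a , b , a≢b , fa⊒fb = suffix-pair⇒weaklyQP f ne a≢b fa⊒fb
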